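{- Let $(V,\mathcal B)$ be a symmetric $2$-$(v,k,\lambda)$ design and let $\mathbf b=\{b_1,\dots,b_k\}\in\mathcal B$ be a block. Suppose $\mathbf b_1,\dots,\mathbf b_k$ are pairwise distinct blocks of $\mathcal B$, none equal to $\mathbf b$, such that (1) $b_i\notin\mathbf b_i$ for all $1\le i\le k$, and (2) for all $j\ne l$ in $\{1,\dots,k\}$, $b_j\in\mathbf b_l$ implies $b_l\notin\mathbf b_j$. Let $\mathcal B'$ be obtained from $\mathcal B$ by adjoining the point $b_i$ to the block $\mathbf b_i$ for every $1\le i\le k$ and then removing the block $\mathbf b$. Then the dual $(V,\mathcal B')^\perp$ is a $2$-$(v-1,k,\lambda)$ adesign.
   Context: A symmetric $2$-$(v,k,\lambda)$ design has $v$ points and $v$ blocks of size $k$, every pair of points lying in exactly $\lambda$ blocks. The dual of an incidence structure $(V,\mathcal C)$ has the blocks of $\mathcal C$ as points, and for each $p\in V$ the block consisting of the members of $\mathcal C$ containing $p$. A $t$-$(v,k,\lambda)$ adesign is an incidence structure with $v$ points and blocks of size $k$ such that every $t$-subset of points lies in exactly $\lambda$ or exactly $\lambda+1$ blocks, both values occurring. -}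

module Defs where

open import Data.Nat using (ℕ; suc)
open import Data.Fin using (Fin; punchIn; _≟_)
open import Data.Fin.Properties using (any?)
open import Data.Fin.Subset using (Subset; _∈_; _∉_; _⊆_; _∪_; ∣_∣)
open import Data.Fin.Subset.Properties using (_∈?_; _⊆?_)
open import Data.Vec using (tabulate)
open import Data.Product using (_×_; ∃; _,_)
open import Data.Product.Properties using () 
open import Relation.Nullary.Decidable using (⌊_⌋; _×-dec_)
open import Relation.Binary.PropositionalEquality using (_≡_)
open import Data.Sum using (_⊎_)

IncStr : ℕ → ℕ → Set
IncStr m b = Fin b → Subset m

blocksThrough : ∀ {m b} → IncStr m b → Subset m → Subset b
blocksThrough B S = tabulate (λ j → ⌊ S ⊆? B j ⌋)

IsDesign : (t v k λ' : ℕ) → ∀ {b} → IncStr v b → Set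
IsDesign t v k λ' B =
  (∀ j → ∣ B j ∣ ≡ k) ×
  (∀ (S : Subset v) → ∣ S ∣ ≡ t → ∣ blocksThrough B S ∣ ≡ λ')

IsSymmetricDesign : (v k λ' : ℕ) → IncStr v v → Set
IsSymmetricDesign v k λ' B = IsDesign 2 v k λ' B

IsADesign : (t v k λ' : ℕ) → ∀ {b} → IncStr v b → Set
IsADesign t v k λ' B =
  (∀ j → ∣ B j ∣ ≡ k) ×
  (∀ (S : Subset v) → ∣ S ∣ ≡ t →
     (∣ blocksThrough B S ∣ ≡ λ') ⊎ (∣ blocksThrough B S ∣ ≡ suc λ')) ×
  (∃ λ (S : Subset v) → (∣ S ∣ ≡ t) × (∣ blocksThrough B S ∣ ≡ λ')) ×
  (∃ λ (S : Subset v) → (∣ S ∣ ≡ t) × (∣ blocksThrough B S ∣ ≡ suc λ'))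

dual : ∀ {m b} → IncStr m b → IncStr b m
dual B p = tabulate (λ j → ⌊ p ∈? B j ⌋)

adjoin : ∀ {m b k} → IncStr m b → (Fin k → Fin b) → (Fin k → Fin m) → IncStr m b
adjoin B c e j =
  B j ∪ tabulate (λ x → ⌊ any? (λ i → (c i ≟ j) ×-dec (e i ≟ x)) ⌋)

removeBlock : ∀ {m n} → IncStr m (suc n) → Fin (suc n) → IncStr m n
removeBlock B β j = B (punchIn β j)

-- A symmetric design has a symmetric dual: every point lies on k blocks and two
-- distinct blocks meet in exactly λ points, because for a fixed block J the
-- intersection numbers with the other n blocks have sum n λ and sum of squares
-- n λ², hence zero variance. After the modification a point x lies on its old
-- blocks and on c i when x = e i, so on k + [x ∈ B β] blocks, and dropping β
-- leaves exactly k. Two remaining blocks J ≠ L meet in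
-- λ + [J = c i, e i ∈ B L] + [L = c j, e j ∈ B J] points, and hypothesis (2)
-- rules out both corrections at once. The value λ + 1 is attained by c 0 and a
-- further block through e 0 (there are k ≥ 2 of them); the value λ by c i and a
-- block F ∉ {β, c 0, …} (it exists as v ≥ k + 2) missing e i (it exists since
-- B β ⊆ B F would give λ = k, contradicting k (k - 1) = n λ with n > k).

module Submission where

open import Defs
open import Data.Bool using (Bool; true; false; _∧_; _∨_)
import Data.Bool.Properties as Bool
open import Data.Empty using (⊥-elim)
open import Data.Nat using (ℕ; zero; suc; _+_; _*_; _≤_; _<_; z≤n; s≤s)
open import Data.Nat.Properties hiding (_≟_)
open import Data.Nat.Tactic.RingSolver using (solve-∀)
open import Data.Fin using (Fin; zero; suc; punchIn; punchOut; _≟_)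
open import Data.Fin.Properties using (any?; punchInᵢ≢i; punchIn-punchOut; punchIn-injective; pigeonhole)
import Data.Fin.Properties as Fin
open import Data.Fin.Subset using (Subset; ⊥; ⁅_⁆; _∪_; _∩_; _∈_; _∉_; _⊆_; ∣_∣)
open import Data.Fin.Subset.Properties using (_∈?_; _⊆?_; ∣⁅x⁆∣≡1; ∪-identityˡ; ∪-identityʳ; x∈p∪q⁻; x∈p∪q⁺; x∈⁅x⁆; x∈⁅y⁆⇒x≡y)
open import Data.Vec using (Vec; []; _∷_; lookup; tabulate)
open import Data.Vec.Properties using (lookup∘tabulate; tabulate∘lookup; tabulate-cong; lookup-zipWith; []=⇒lookup; lookup⇒[]=)
open import Data.Product using (∃; ∃₂; _×_; _,_; proj₁; proj₂)
open import Data.Sum using (_⊎_; inj₁; inj₂; reduce)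
open import Function using (_∘_)
open import Function.Bundles using (_⇔_; mk⇔; Equivalence)
open import Function.Definitions using (Injective)
open import Relation.Nullary using (¬_; yes; no; ¬?; contradiction)
open import Relation.Nullary.Decidable using (⌊_⌋; does; does-⇔; isYes≗does; _×-dec_; toWitness; fromWitness; decidable-stable)
open import Relation.Binary.PropositionalEquality
open import Algebra.Properties.Semiring.Sum +-*-semiring
  using (sum; sum-syntax; sum-remove; sum-cong-≗; sum-replicate-zero; ∑-distrib-+; ∑-comm; *-distribˡ-sum; *-distribʳ-sum)

𝟙 : Bool → ℕ
𝟙 true = 1
𝟙 false = 0

𝟙-∧ : ∀ a b → 𝟙 (a ∧ b) ≡ 𝟙 a * 𝟙 b
𝟙-∧ true b = sym (+-identityʳ (𝟙 b))
𝟙-∧ false b = refl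

𝟙-idem : ∀ a → 𝟙 a * 𝟙 a ≡ 𝟙 a
𝟙-idem true = refl
𝟙-idem false = refl

𝟙≤1 : ∀ a → 𝟙 a ≤ 1
𝟙≤1 true = s≤s z≤n
𝟙≤1 false = z≤n

𝟙*-cong : ∀ a {m p} → (a ≡ true → m ≡ p) → 𝟙 a * m ≡ 𝟙 a * p
𝟙*-cong true m≡p = cong (1 *_) (m≡p refl)
𝟙*-cong false _ = refl

𝟙≡0 : ∀ {a} → ¬ (a ≡ true) → 𝟙 a ≡ 0
𝟙≡0 {true} a≢true = ⊥-elim (a≢true refl)
𝟙≡0 {false} _ = refl

𝟙≡1⇒≡true : ∀ {a} → 𝟙 a ≡ 1 → a ≡ true
𝟙≡1⇒≡true {true} _ = refl

𝟙-∨ : ∀ a b → (a ≡ true → ¬ (b ≡ true)) → 𝟙 (a ∨ b) ≡ 𝟙 a + 𝟙 b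
𝟙-∨ true true disjoint = ⊥-elim (disjoint refl refl)
𝟙-∨ true false _ = refl
𝟙-∨ false b _ = refl

𝟙*𝟙≡0 : ∀ a b → (a ≡ true → ¬ (b ≡ true)) → 𝟙 a * 𝟙 b ≡ 0
𝟙*𝟙≡0 true true disjoint = ⊥-elim (disjoint refl refl)
𝟙*𝟙≡0 true false _ = refl
𝟙*𝟙≡0 false b _ = refl

∣p∣≡∑𝟙 : ∀ {n} (p : Subset n) → ∣ p ∣ ≡ ∑[ x < n ] 𝟙 (lookup p x)
∣p∣≡∑𝟙 [] = refl
∣p∣≡∑𝟙 (true ∷ p) = cong suc (∣p∣≡∑𝟙 p)
∣p∣≡∑𝟙 (false ∷ p) = ∣p∣≡∑𝟙 p

∣p∩q∣≡∑𝟙 : ∀ {n} (p q : Subset n) →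
  ∣ p ∩ q ∣ ≡ ∑[ x < n ] (𝟙 (lookup p x) * 𝟙 (lookup q x))
∣p∩q∣≡∑𝟙 p q = trans (∣p∣≡∑𝟙 (p ∩ q)) (sum-cong-≗ λ x →
  trans (cong 𝟙 (lookup-zipWith _∧_ x p q)) (𝟙-∧ (lookup p x) (lookup q x)))

∑-const : ∀ n c → ∑[ i < n ] c ≡ n * c
∑-const zero c = refl
∑-const (suc n) c = cong (c +_) (∑-const n c)

∑-zero : ∀ {n} {f : Fin n → ℕ} → (∀ i → f i ≡ 0) → sum f ≡ 0
∑-zero {n} f≡0 = trans (sum-cong-≗ f≡0) (sum-replicate-zero n)

∑-supported : ∀ {n} {f : Fin (suc n) → ℕ} x → (∀ i → i ≢ x → f i ≡ 0) → sum f ≡ f x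
∑-supported {f = f} x f≡0 = begin
  sum f                                   ≡⟨ sum-remove {i = x} f ⟩
  f x + ∑[ i < _ ] f (punchIn x i)         ≡⟨ cong (f x +_) (∑-zero (λ i → f≡0 _ (punchInᵢ≢i x i))) ⟩
  f x + 0                                 ≡⟨ +-identityʳ (f x) ⟩
  f x                                     ∎
  where open ≡-Reasoning

∑-mono-≤ : ∀ {n} {f g : Fin n → ℕ} → (∀ i → f i ≤ g i) → sum f ≤ sum g
∑-mono-≤ {zero} f≤g = z≤n
∑-mono-≤ {suc n} f≤g = +-mono-≤ (f≤g zero) (∑-mono-≤ (f≤g ∘ suc))

∑-≤-equality : ∀ {n} {f g : Fin n → ℕ} → (∀ i → f i ≤ g i) → sum f ≡ sum g → ∀ i → f i ≡ g i
∑-≤-equality {suc n} {f} {g} f≤g ∑f≡∑g = go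
  where
  head≡ : f zero ≡ g zero
  head≡ = ≤-antisym (f≤g zero) (+-cancelʳ-≤ _ _ _
    (≤-trans (≤-reflexive (sym ∑f≡∑g)) (+-monoʳ-≤ (f zero) (∑-mono-≤ (f≤g ∘ suc)))))
  go : ∀ i → f i ≡ g i
  go zero = head≡
  go (suc i) = ∑-≤-equality (f≤g ∘ suc)
    (+-cancelˡ-≡ (f zero) _ _ (trans ∑f≡∑g (cong (_+ _) (sym head≡)))) i

∣⁅x⁆∪⁅y⁆∣≡2 : ∀ {n} {x y : Fin n} → x ≢ y → ∣ ⁅ x ⁆ ∪ ⁅ y ⁆ ∣ ≡ 2
∣⁅x⁆∪⁅y⁆∣≡2 {x = zero} {zero} x≢y = ⊥-elim (x≢y refl)
∣⁅x⁆∪⁅y⁆∣≡2 {x = zero} {suc y} _ = trans (cong (suc ∘ ∣_∣) (∪-identityˡ ⁅ y ⁆)) (cong suc (∣⁅x⁆∣≡1 y))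
∣⁅x⁆∪⁅y⁆∣≡2 {x = suc x} {zero} _ = trans (cong (suc ∘ ∣_∣) (∪-identityʳ ⁅ x ⁆)) (cong suc (∣⁅x⁆∣≡1 x))
∣⁅x⁆∪⁅y⁆∣≡2 {x = suc x} {suc y} x≢y = ∣⁅x⁆∪⁅y⁆∣≡2 (x≢y ∘ cong suc)

∣p∣≡0⇒p≡⊥ : ∀ {n} (p : Subset n) → ∣ p ∣ ≡ 0 → p ≡ ⊥
∣p∣≡0⇒p≡⊥ [] _ = refl
∣p∣≡0⇒p≡⊥ (false ∷ p) ∣p∣≡0 = cong (false ∷_) (∣p∣≡0⇒p≡⊥ p ∣p∣≡0)

∣p∣≡1⇒p≡⁅x⁆ : ∀ {n} (p : Subset n) → ∣ p ∣ ≡ 1 → ∃ λ x → p ≡ ⁅ x ⁆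
∣p∣≡1⇒p≡⁅x⁆ (true ∷ p) ∣p∣≡1 = zero , cong (true ∷_) (∣p∣≡0⇒p≡⊥ p (suc-injective ∣p∣≡1))
∣p∣≡1⇒p≡⁅x⁆ (false ∷ p) ∣p∣≡1 with ∣p∣≡1⇒p≡⁅x⁆ p ∣p∣≡1
... | x , p≡⁅x⁆ = suc x , cong (false ∷_) p≡⁅x⁆

∣p∣≡2⇒p≡⁅x⁆∪⁅y⁆ : ∀ {n} (p : Subset n) → ∣ p ∣ ≡ 2 →
  ∃₂ λ x y → x ≢ y × p ≡ ⁅ x ⁆ ∪ ⁅ y ⁆
∣p∣≡2⇒p≡⁅x⁆∪⁅y⁆ (true ∷ p) ∣p∣≡2 with ∣p∣≡1⇒p≡⁅x⁆ p (suc-injective ∣p∣≡2)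
... | y , p≡⁅y⁆ = zero , suc y , (λ ()) , cong (true ∷_) (trans p≡⁅y⁆ (sym (∪-identityˡ ⁅ y ⁆)))
∣p∣≡2⇒p≡⁅x⁆∪⁅y⁆ (false ∷ p) ∣p∣≡2 with ∣p∣≡2⇒p≡⁅x⁆∪⁅y⁆ p ∣p∣≡2
... | x , y , x≢y , p≡ = suc x , suc y , x≢y ∘ Fin.suc-injective , cong (false ∷_) p≡

lookup-ext : ∀ {a} {A : Set a} {n} {xs ys : Vec A n} → (∀ i → lookup xs i ≡ lookup ys i) → xs ≡ ys
lookup-ext {xs = xs} {ys} xs≗ys =
  trans (sym (tabulate∘lookup xs)) (trans (tabulate-cong xs≗ys) (tabulate∘lookup ys))

does-∈? : ∀ {n} (x : Fin n) (p : Subset n) → does (x ∈? p) ≡ lookup p x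
does-∈? zero (true ∷ p) = refl
does-∈? zero (false ∷ p) = refl
does-∈? (suc x) (_ ∷ p) = does-∈? x p

⌊x∈?p⌋≡lookup : ∀ {n} (x : Fin n) (p : Subset n) → ⌊ x ∈? p ⌋ ≡ lookup p x
⌊x∈?p⌋≡lookup x p = trans (isYes≗does (x ∈? p)) (does-∈? x p)

⁅x⁆∪⁅y⁆⊆p⇔ : ∀ {n} {x y : Fin n} {p : Subset n} → ⁅ x ⁆ ∪ ⁅ y ⁆ ⊆ p ⇔ (x ∈ p × y ∈ p)
⁅x⁆∪⁅y⁆⊆p⇔ {x = x} {y} {p} = mk⇔
  (λ sub → sub (x∈p∪q⁺ (inj₁ (x∈⁅x⁆ x))) , sub (x∈p∪q⁺ (inj₂ (x∈⁅x⁆ y))))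
  from
  where
  from : x ∈ p × y ∈ p → ⁅ x ⁆ ∪ ⁅ y ⁆ ⊆ p
  from (x∈p , y∈p) z∈ with x∈p∪q⁻ ⁅ x ⁆ ⁅ y ⁆ z∈
  ... | inj₁ z∈⁅x⁆ = subst (_∈ p) (sym (x∈⁅y⁆⇒x≡y x z∈⁅x⁆)) x∈p
  ... | inj₂ z∈⁅y⁆ = subst (_∈ p) (sym (x∈⁅y⁆⇒x≡y y z∈⁅y⁆)) y∈p

⌊⁅x⁆∪⁅y⁆⊆?p⌋ : ∀ {n} (x y : Fin n) (p : Subset n) →
  ⌊ ⁅ x ⁆ ∪ ⁅ y ⁆ ⊆? p ⌋ ≡ lookup p x ∧ lookup p y
⌊⁅x⁆∪⁅y⁆⊆?p⌋ x y p = begin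
  ⌊ ⁅ x ⁆ ∪ ⁅ y ⁆ ⊆? p ⌋            ≡⟨ isYes≗does (⁅ x ⁆ ∪ ⁅ y ⁆ ⊆? p) ⟩
  does (⁅ x ⁆ ∪ ⁅ y ⁆ ⊆? p)         ≡⟨ does-⇔ ⁅x⁆∪⁅y⁆⊆p⇔ (⁅ x ⁆ ∪ ⁅ y ⁆ ⊆? p) (x ∈? p ×-dec y ∈? p) ⟩
  does (x ∈? p) ∧ does (y ∈? p)      ≡⟨ cong₂ _∧_ (does-∈? x p) (does-∈? y p) ⟩
  lookup p x ∧ lookup p y           ∎
  where open ≡-Reasoning

lookup-dual : ∀ {m b} (B : IncStr m b) x j → lookup (dual B x) j ≡ lookup (B j) x
lookup-dual B x j = trans (lookup∘tabulate _ j) (⌊x∈?p⌋≡lookup x (B j))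

dual-involutive : ∀ {m b} (B : IncStr m b) j → dual (dual B) j ≡ B j
dual-involutive B j = lookup-ext λ x → trans (lookup-dual (dual B) j x) (lookup-dual B x j)

blocksThrough-pair : ∀ {m b} (B : IncStr m b) x y →
  blocksThrough B (⁅ x ⁆ ∪ ⁅ y ⁆) ≡ dual B x ∩ dual B y
blocksThrough-pair B x y = lookup-ext λ j → begin
  lookup (blocksThrough B (⁅ x ⁆ ∪ ⁅ y ⁆)) j  ≡⟨ lookup∘tabulate _ j ⟩
  ⌊ ⁅ x ⁆ ∪ ⁅ y ⁆ ⊆? B j ⌋                   ≡⟨ ⌊⁅x⁆∪⁅y⁆⊆?p⌋ x y (B j) ⟩
  lookup (B j) x ∧ lookup (B j) y            ≡⟨ sym (cong₂ _∧_ (lookup-dual B x j) (lookup-dual B y j)) ⟩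
  lookup (dual B x) j ∧ lookup (dual B y) j  ≡⟨ sym (lookup-zipWith _∧_ j (dual B x) (dual B y)) ⟩
  lookup (dual B x ∩ dual B y) j             ∎
  where open ≡-Reasoning

∣dual∣≡∑𝟙 : ∀ {m b} (B : IncStr m b) x → ∣ dual B x ∣ ≡ ∑[ j < b ] 𝟙 (lookup (B j) x)
∣dual∣≡∑𝟙 B x = trans (∣p∣≡∑𝟙 (dual B x)) (sum-cong-≗ λ j → cong 𝟙 (lookup-dual B x j))

∣blocksThrough-dual-pair∣ : ∀ {m b} (B : IncStr m b) j l →
  ∣ blocksThrough (dual B) (⁅ j ⁆ ∪ ⁅ l ⁆) ∣ ≡ ∣ B j ∩ B l ∣
∣blocksThrough-dual-pair∣ B j l = cong ∣_∣ (trans (blocksThrough-pair (dual B) j l)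
  (cong₂ _∩_ (dual-involutive B j) (dual-involutive B l)))

∣blocksThrough∣-from-pairs : ∀ {m b} (B : IncStr m b) (P : ℕ → Set) →
  (∀ {x y} → x ≢ y → P ∣ blocksThrough B (⁅ x ⁆ ∪ ⁅ y ⁆) ∣) →
  ∀ S → ∣ S ∣ ≡ 2 → P ∣ blocksThrough B S ∣
∣blocksThrough∣-from-pairs B P pairs S ∣S∣≡2 with ∣p∣≡2⇒p≡⁅x⁆∪⁅y⁆ S ∣S∣≡2
... | x , y , x≢y , refl = pairs x≢y

private
  square-gap : ∀ m d → m * (m + d) + m * (m + d) + d * d ≡ m * m + (m + d) * (m + d)
  square-gap = solve-∀

  amgm-≤ : ∀ {m n} → m ≤ n → m * n + m * n ≤ m * m + n * n
  amgm-≤ {m} m≤n with d , refl ← m≤n⇒∃[o]m+o≡n m≤n =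
    ≤-trans (m≤m+n _ (d * d)) (≤-reflexive (square-gap m d))

  amgm-≤-equality : ∀ {m n} → m ≤ n → m * n + m * n ≡ m * m + n * n → m ≡ n
  amgm-≤-equality {m} m≤n eq with d , refl ← m≤n⇒∃[o]m+o≡n m≤n =
    sym (trans (cong (m +_) (reduce (m*n≡0⇒m≡0∨n≡0 d d*d≡0))) (+-identityʳ m))
    where
    d*d≡0 : d * d ≡ 0
    d*d≡0 = +-cancelˡ-≡ _ _ _ (trans (trans (square-gap m d) (sym eq)) (sym (+-identityʳ _)))

  flip-amgm : ∀ m n → n * m + n * m ≡ m * n + m * n
  flip-amgm m n = cong₂ _+_ (*-comm n m) (*-comm n m)

m*n+m*n≤m*m+n*n : ∀ m n → m * n + m * n ≤ m * m + n * n
m*n+m*n≤m*m+n*n m n with ≤-total m n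
... | inj₁ m≤n = amgm-≤ m≤n
... | inj₂ n≤m = subst₂ _≤_ (flip-amgm m n) (+-comm (n * n) (m * m)) (amgm-≤ n≤m)

m*n+m*n≡m*m+n*n⇒m≡n : ∀ m n → m * n + m * n ≡ m * m + n * n → m ≡ n
m*n+m*n≡m*m+n*n⇒m≡n m n eq with ≤-total m n
... | inj₁ m≤n = amgm-≤-equality m≤n eq
... | inj₂ n≤m = sym (amgm-≤-equality n≤m
  (trans (flip-amgm m n) (trans eq (+-comm (m * m) (n * n)))))

∑-mean-equality : ∀ {n} (y : Fin n → ℕ) l →
  ∑[ i < n ] y i ≡ n * l → ∑[ i < n ] (y i * y i) ≡ n * (l * l) → ∀ i → y i ≡ l
∑-mean-equality {n} y l ∑y ∑y² i = m*n+m*n≡m*m+n*n⇒m≡n (y i) l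
  (∑-≤-equality (λ j → m*n+m*n≤m*m+n*n (y j) l) ∑2yl≡∑[y²+l²] i)
  where
  open ≡-Reasoning
  ∑yl : ∑[ j < n ] (y j * l) ≡ n * (l * l)
  ∑yl = trans (sym (*-distribʳ-sum l y)) (trans (cong (_* l) ∑y) (*-assoc n l l))
  ∑2yl≡∑[y²+l²] : ∑[ j < n ] (y j * l + y j * l) ≡ ∑[ j < n ] (y j * y j + l * l)
  ∑2yl≡∑[y²+l²] = begin
    ∑[ j < n ] (y j * l + y j * l)              ≡⟨ ∑-distrib-+ (λ j → y j * l) (λ j → y j * l) ⟩
    ∑[ j < n ] (y j * l) + ∑[ j < n ] (y j * l) ≡⟨ cong₂ _+_ ∑yl ∑yl ⟩
    n * (l * l) + n * (l * l)                   ≡⟨ cong₂ _+_ (sym ∑y²) (sym (∑-const n (l * l))) ⟩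
    ∑[ j < n ] (y j * y j) + ∑[ j < n ] (l * l) ≡⟨ sym (∑-distrib-+ (λ j → y j * y j) (λ _ → l * l)) ⟩
    ∑[ j < n ] (y j * y j + l * l)              ∎

module TwoDesign {n b k₁ λ'} (B : IncStr (suc n) b) (design : IsDesign 2 (suc n) (suc k₁) λ' B) where

  χ : Fin b → Fin (suc n) → ℕ
  χ j x = 𝟙 (lookup (B j) x)

  ∑χ≡k : ∀ j → ∑[ x < suc n ] χ j x ≡ suc k₁
  ∑χ≡k j = trans (sym (∣p∣≡∑𝟙 (B j))) (proj₁ design j)

  ∑χ-others : ∀ {j x} → lookup (B j) x ≡ true → ∑[ y < n ] χ j (punchIn x y) ≡ k₁
  ∑χ-others {j} {x} x∈Bj = suc-injective (begin
    suc (∑[ y < n ] χ j (punchIn x y)) ≡⟨ cong (λ a → 𝟙 a + ∑[ y < n ] χ j (punchIn x y)) (sym x∈Bj) ⟩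
    χ j x + ∑[ y < n ] χ j (punchIn x y) ≡⟨ sym (sum-remove {i = x} (χ j)) ⟩
    ∑[ y < suc n ] χ j y                ≡⟨ ∑χ≡k j ⟩
    suc k₁                              ∎)
    where open ≡-Reasoning

  ∑χχ≡λ : ∀ {x y} → x ≢ y → ∑[ j < b ] (χ j x * χ j y) ≡ λ'
  ∑χχ≡λ {x} {y} x≢y = begin
    ∑[ j < b ] (χ j x * χ j y)
      ≡⟨ sum-cong-≗ (λ j → sym (cong₂ (λ s t → 𝟙 s * 𝟙 t) (lookup-dual B x j) (lookup-dual B y j))) ⟩
    ∑[ j < b ] (𝟙 (lookup (dual B x) j) * 𝟙 (lookup (dual B y) j))
      ≡⟨ sym (∣p∩q∣≡∑𝟙 (dual B x) (dual B y)) ⟩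
    ∣ dual B x ∩ dual B y ∣               ≡⟨ cong ∣_∣ (sym (blocksThrough-pair B x y)) ⟩
    ∣ blocksThrough B (⁅ x ⁆ ∪ ⁅ y ⁆) ∣   ≡⟨ proj₂ design _ (∣⁅x⁆∪⁅y⁆∣≡2 x≢y) ⟩
    λ'                                    ∎
    where open ≡-Reasoning

  -- Double count the pairs (j , y) with y ≠ x and x, y ∈ B j.
  replication : ∀ x → (∑[ j < b ] χ j x) * k₁ ≡ n * λ'
  replication x = begin
    (∑[ j < b ] χ j x) * k₁                          ≡⟨ *-distribʳ-sum k₁ (λ j → χ j x) ⟩
    ∑[ j < b ] (χ j x * k₁)                          ≡⟨ sum-cong-≗ (λ j → 𝟙*-cong (lookup (B j) x) (sym ∘ ∑χ-others)) ⟩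
    ∑[ j < b ] (χ j x * ∑[ y < n ] χ j (punchIn x y)) ≡⟨ sum-cong-≗ (λ j → *-distribˡ-sum (χ j x) (λ y → χ j (punchIn x y))) ⟩
    ∑[ j < b ] ∑[ y < n ] (χ j x * χ j (punchIn x y)) ≡⟨ ∑-comm (λ j y → χ j x * χ j (punchIn x y)) ⟩
    ∑[ y < n ] ∑[ j < b ] (χ j x * χ j (punchIn x y)) ≡⟨ sum-cong-≗ (λ y → ∑χχ≡λ (punchInᵢ≢i x y ∘ sym)) ⟩
    ∑[ y < n ] λ'                                    ≡⟨ ∑-const n λ' ⟩
    n * λ'                                           ∎
    where open ≡-Reasoning

module SymmetricDesign {n k₂ λ'} (B : IncStr (suc n) (suc n))
  (design : IsSymmetricDesign (suc n) (2 + k₂) λ' B) where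

  -- Writing k = 2 + k₂ keeps k - 1 nonzero, so replication pins down r.
  open TwoDesign B design public

  private
    v k₁ k : ℕ
    v = suc n
    k₁ = suc k₂
    k = suc k₁

  replication≡k : ∀ x → ∑[ J < v ] χ J x ≡ k
  replication≡k x = trans (r-constant x) r₀≡k
    where
    open ≡-Reasoning
    r : Fin v → ℕ
    r x = ∑[ J < v ] χ J x
    r-constant : ∀ x → r x ≡ r zero
    r-constant x = *-cancelʳ-≡ (r x) (r zero) k₁ (trans (replication x) (sym (replication zero)))
    r₀≡k : r zero ≡ k
    r₀≡k = *-cancelˡ-≡ (r zero) k v (begin
      v * r zero                ≡⟨ sym (∑-const v (r zero)) ⟩
      ∑[ x < v ] r zero         ≡⟨ sum-cong-≗ (sym ∘ r-constant) ⟩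
      ∑[ x < v ] r x            ≡⟨ ∑-comm (λ x J → χ J x) ⟩
      ∑[ J < v ] ∑[ x < v ] χ J x ≡⟨ sum-cong-≗ ∑χ≡k ⟩
      ∑[ J < v ] k              ≡⟨ ∑-const v k ⟩
      v * k                     ∎)

  k*k₁≡n*λ : k * k₁ ≡ n * λ'
  k*k₁≡n*λ = trans (cong (_* k₁) (sym (replication≡k zero))) (replication zero)

  meet : Fin v → Fin v → ℕ
  meet J L = ∑[ x < v ] (χ J x * χ L x)

  meet-self : ∀ J → meet J J ≡ k
  meet-self J = trans (sum-cong-≗ (λ x → 𝟙-idem (lookup (B J) x))) (∑χ≡k J)

  ∑-meet : ∀ J → ∑[ L < v ] meet J L ≡ k * k
  ∑-meet J = begin
    ∑[ L < v ] ∑[ x < v ] (χ J x * χ L x) ≡⟨ ∑-comm (λ L x → χ J x * χ L x) ⟩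
    ∑[ x < v ] ∑[ L < v ] (χ J x * χ L x) ≡⟨ sum-cong-≗ (λ x → sym (*-distribˡ-sum (χ J x) (λ L → χ L x))) ⟩
    ∑[ x < v ] (χ J x * ∑[ L < v ] χ L x) ≡⟨ sum-cong-≗ (λ x → cong (χ J x *_) (replication≡k x)) ⟩
    ∑[ x < v ] (χ J x * k)               ≡⟨ sym (*-distribʳ-sum k (χ J)) ⟩
    (∑[ x < v ] χ J x) * k               ≡⟨ cong (_* k) (∑χ≡k J) ⟩
    k * k                                ∎
    where open ≡-Reasoning

  through : Fin v → Fin v → ℕ
  through x y = ∑[ L < v ] (χ L x * χ L y)

  ∑χ-through : ∀ {J x} → lookup (B J) x ≡ true → ∑[ y < v ] (χ J y * through x y) ≡ k + k₁ * λ'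
  ∑χ-through {J} {x} x∈BJ = begin
    ∑[ y < v ] (χ J y * through x y)                        ≡⟨ sum-remove {i = x} (λ y → χ J y * through x y) ⟩
    χ J x * through x x + ∑[ y < n ] (χ J (punchIn x y) * through x (punchIn x y))
      ≡⟨ cong₂ _+_ on-x off-x ⟩
    k + ∑[ y < n ] (χ J (punchIn x y) * λ')                 ≡⟨ cong (k +_) (sym (*-distribʳ-sum λ' (χ J ∘ punchIn x))) ⟩
    k + (∑[ y < n ] χ J (punchIn x y)) * λ'                 ≡⟨ cong (λ s → k + s * λ') (∑χ-others x∈BJ) ⟩
    k + k₁ * λ'                                             ∎
    where
    open ≡-Reasoning
    on-x : χ J x * through x x ≡ k
    on-x = begin
      χ J x * through x x ≡⟨ cong (λ a → 𝟙 a * through x x) x∈BJ ⟩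
      1 * through x x     ≡⟨ *-identityˡ (through x x) ⟩
      through x x         ≡⟨ sum-cong-≗ (λ L → 𝟙-idem (lookup (B L) x)) ⟩
      ∑[ L < v ] χ L x    ≡⟨ replication≡k x ⟩
      k                   ∎
    off-x : ∑[ y < n ] (χ J (punchIn x y) * through x (punchIn x y)) ≡ ∑[ y < n ] (χ J (punchIn x y) * λ')
    off-x = sum-cong-≗ (λ y → cong (χ J (punchIn x y) *_) (∑χχ≡λ (punchInᵢ≢i x y ∘ sym)))

  meet²-expand : ∀ J L → meet J L * meet J L ≡ ∑[ x < v ] ∑[ y < v ] ((χ J x * χ L x) * (χ J y * χ L y))
  meet²-expand J L = trans (*-distribʳ-sum (meet J L) (λ x → χ J x * χ L x))
    (sum-cong-≗ (λ x → *-distribˡ-sum (χ J x * χ L x) (λ y → χ J y * χ L y)))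

  ∑-meet² : ∀ J → ∑[ L < v ] (meet J L * meet J L) ≡ k * (k + k₁ * λ')
  ∑-meet² J = begin
    ∑[ L < v ] (meet J L * meet J L)                     ≡⟨ sum-cong-≗ (meet²-expand J) ⟩
    ∑[ L < v ] ∑[ x < v ] ∑[ y < v ] f L x y             ≡⟨ ∑-comm (λ L x → ∑[ y < v ] f L x y) ⟩
    ∑[ x < v ] ∑[ L < v ] ∑[ y < v ] f L x y             ≡⟨ sum-cong-≗ (λ x → ∑-comm (λ L y → f L x y)) ⟩
    ∑[ x < v ] ∑[ y < v ] ∑[ L < v ] f L x y             ≡⟨ sum-cong-≗ (λ x → sum-cong-≗ (∑f x)) ⟩
    ∑[ x < v ] ∑[ y < v ] (χ J x * (χ J y * through x y)) ≡⟨ sum-cong-≗ (λ x → sym (*-distribˡ-sum (χ J x) (λ y → χ J y * through x y))) ⟩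
    ∑[ x < v ] (χ J x * ∑[ y < v ] (χ J y * through x y)) ≡⟨ sum-cong-≗ (λ x → 𝟙*-cong (lookup (B J) x) ∑χ-through) ⟩
    ∑[ x < v ] (χ J x * (k + k₁ * λ'))                   ≡⟨ sym (*-distribʳ-sum (k + k₁ * λ') (χ J)) ⟩
    (∑[ x < v ] χ J x) * (k + k₁ * λ')                   ≡⟨ cong (_* (k + k₁ * λ')) (∑χ≡k J) ⟩
    k * (k + k₁ * λ')                                    ∎
    where
    open ≡-Reasoning
    f : Fin v → Fin v → Fin v → ℕ
    f L x y = (χ J x * χ L x) * (χ J y * χ L y)
    rearrange : ∀ a b c d → (a * c) * (b * d) ≡ a * (b * (c * d))
    rearrange = solve-∀
    ∑f : ∀ x y → ∑[ L < v ] f L x y ≡ χ J x * (χ J y * through x y)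
    ∑f x y = begin
      ∑[ L < v ] f L x y                                ≡⟨ sum-cong-≗ (λ L → rearrange (χ J x) (χ J y) (χ L x) (χ L y)) ⟩
      ∑[ L < v ] (χ J x * (χ J y * (χ L x * χ L y)))    ≡⟨ sym (*-distribˡ-sum (χ J x) (λ L → χ J y * (χ L x * χ L y))) ⟩
      χ J x * ∑[ L < v ] (χ J y * (χ L x * χ L y))      ≡⟨ cong (χ J x *_) (sym (*-distribˡ-sum (χ J y) (λ L → χ L x * χ L y))) ⟩
      χ J x * (χ J y * through x y)                     ∎

  -- With y L = meet J L for L ≠ J, the two sums force mean λ and variance 0.
  blocks-meet-in-λ : ∀ {J L} → J ≢ L → meet J L ≡ λ'
  blocks-meet-in-λ {J} {L} J≢L = begin
    meet J L              ≡⟨ cong (meet J) (sym (punchIn-punchOut J≢L)) ⟩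
    y (punchOut J≢L)      ≡⟨ ∑-mean-equality y λ' ∑y ∑y² (punchOut J≢L) ⟩
    λ'                    ∎
    where
    open ≡-Reasoning
    y : Fin n → ℕ
    y L = meet J (punchIn J L)
    ∑y : ∑[ L < n ] y L ≡ n * λ'
    ∑y = +-cancelˡ-≡ k _ _ (begin
      k + ∑[ L < n ] y L        ≡⟨ cong (_+ ∑[ L < n ] y L) (sym (meet-self J)) ⟩
      meet J J + ∑[ L < n ] y L ≡⟨ sym (sum-remove {i = J} (meet J)) ⟩
      ∑[ L < v ] meet J L       ≡⟨ ∑-meet J ⟩
      k * k                     ≡⟨ *-suc k k₁ ⟩
      k + k * k₁                ≡⟨ cong (k +_) k*k₁≡n*λ ⟩
      k + n * λ'                ∎)
    ∑y² : ∑[ L < n ] (y L * y L) ≡ n * (λ' * λ')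
    ∑y² = +-cancelˡ-≡ (k * k) _ _ (begin
      k * k + ∑[ L < n ] (y L * y L)
        ≡⟨ cong (_+ ∑[ L < n ] (y L * y L)) (sym (cong₂ _*_ (meet-self J) (meet-self J))) ⟩
      meet J J * meet J J + ∑[ L < n ] (y L * y L) ≡⟨ sym (sum-remove {i = J} (λ L → meet J L * meet J L)) ⟩
      ∑[ L < v ] (meet J L * meet J L)   ≡⟨ ∑-meet² J ⟩
      k * (k + k₁ * λ')                  ≡⟨ *-distribˡ-+ k k (k₁ * λ') ⟩
      k * k + k * (k₁ * λ')              ≡⟨ cong (k * k +_) (sym (*-assoc k k₁ λ')) ⟩
      k * k + k * k₁ * λ'                ≡⟨ cong (λ t → k * k + t * λ') k*k₁≡n*λ ⟩
      k * k + n * λ' * λ'                ≡⟨ cong (k * k +_) (*-assoc n λ' λ') ⟩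
      k * k + n * (λ' * λ')              ∎)

m+a+b≡m⊎m+a+b≡1+m : ∀ m {a b} → a ≤ 1 → b ≤ 1 → (a ≡ 1 → b ≡ 0) →
  (m + a + b ≡ m) ⊎ (m + a + b ≡ suc m)
m+a+b≡m⊎m+a+b≡1+m m {zero} {zero} _ _ _ = inj₁ (trans (+-identityʳ _) (+-identityʳ m))
m+a+b≡m⊎m+a+b≡1+m m {zero} {suc zero} _ _ _ = inj₂ (trans (cong (_+ 1) (+-identityʳ m)) (+-comm m 1))
m+a+b≡m⊎m+a+b≡1+m m {suc zero} {zero} _ _ _ = inj₂ (trans (+-identityʳ _) (+-comm m 1))
m+a+b≡m⊎m+a+b≡1+m m {suc zero} {suc zero} _ _ a≡1⇒b≡0 with () ← a≡1⇒b≡0 refl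
m+a+b≡m⊎m+a+b≡1+m m {suc (suc _)} (s≤s ()) _ _
m+a+b≡m⊎m+a+b≡1+m m {_} {suc (suc _)} _ (s≤s ()) _

module Modified {n k₂ λ'} (k+2≤v : 2 + k₂ + 2 ≤ suc n)
  (B : IncStr (suc n) (suc n)) (design : IsSymmetricDesign (suc n) (2 + k₂) λ' B)
  (β : Fin (suc n))
  (e : Fin (2 + k₂) → Fin (suc n)) (e-inj : Injective _≡_ _≡_ e)
  (Bβ≡e : ∀ x → (x ∈ B β) ⇔ (∃ λ i → e i ≡ x))
  (c : Fin (2 + k₂) → Fin (suc n)) (c-inj : Injective _≡_ _≡_ c) (c≢β : ∀ i → c i ≢ β)
  (e∉c : ∀ i → e i ∉ B (c i))
  (asym : ∀ i j → i ≢ j → e i ∈ B (c j) → e j ∉ B (c i)) where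

  open SymmetricDesign B design

  private
    v k : ℕ
    v = suc n
    k = 2 + k₂

  B′ : IncStr v v
  B′ = adjoin B c e

  is-added : Fin v → Fin v → Bool
  is-added J x = ⌊ any? (λ i → (c i ≟ J) ×-dec (e i ≟ x)) ⌋

  added : Fin v → Subset v
  added J = tabulate (is-added J)

  α χ′ : Fin v → Fin v → ℕ
  α J x = 𝟙 (lookup (added J) x)
  χ′ J x = 𝟙 (lookup (B′ J) x)

  added⁻ : ∀ J x → lookup (added J) x ≡ true → ∃ λ i → c i ≡ J × e i ≡ x
  added⁻ J x x∈added = toWitness (Equivalence.from Bool.T-≡ (trans (sym (lookup∘tabulate (is-added J) x)) x∈added))

  added⁺ : ∀ i → lookup (added (c i)) (e i) ≡ true
  added⁺ i = trans (lookup∘tabulate (is-added (c i)) (e i)) (Equivalence.to Bool.T-≡ (fromWitness (i , refl , refl)))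

  e∈Bβ : ∀ i → lookup (B β) (e i) ≡ true
  e∈Bβ i = []=⇒lookup (Equivalence.from (Bβ≡e (e i)) (i , refl))

  χ′≡χ+α : ∀ J x → χ′ J x ≡ χ J x + α J x
  χ′≡χ+α J x = trans (cong 𝟙 (lookup-zipWith _∨_ x (B J) (added J))) (𝟙-∨ _ _ disjoint)
    where
    disjoint : lookup (B J) x ≡ true → ¬ (lookup (added J) x ≡ true)
    disjoint x∈BJ x∈added with added⁻ J x x∈added
    ... | i , refl , refl = e∉c i (lookup⇒[]= _ (B (c i)) x∈BJ)

  α-β : ∀ x → α β x ≡ 0
  α-β x = 𝟙≡0 (λ x∈added → let i , ci≡β , _ = added⁻ β x x∈added in c≢β i ci≡β)

  ∑α≡χβ : ∀ x → ∑[ J < v ] α J x ≡ χ β x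
  ∑α≡χβ x with lookup (B β) x in x∈Bβ
  ... | false = ∑-zero λ J → 𝟙≡0 (x∉added J)
    where
    x∉added : ∀ J → ¬ (lookup (added J) x ≡ true)
    x∉added J x∈added with added⁻ J x x∈added
    ... | i , _ , refl with () ← trans (sym (e∈Bβ i)) x∈Bβ
  ... | true with Equivalence.to (Bβ≡e x) (lookup⇒[]= x (B β) x∈Bβ)
  ...   | i , refl = trans (∑-supported (c i) not-c) (cong 𝟙 (added⁺ i))
    where
    not-c : ∀ J → J ≢ c i → α J (e i) ≡ 0
    not-c J J≢ci = 𝟙≡0 λ ei∈added →
      let i′ , ci′≡J , ei′≡ei = added⁻ J (e i) ei∈added in J≢ci (trans (sym ci′≡J) (cong c (e-inj ei′≡ei)))

  dual-block-size : ∀ x → ∑[ j < n ] χ′ (punchIn β j) x ≡ k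
  dual-block-size x = +-cancelˡ-≡ (χ β x) _ _ (begin
    χ β x + ∑[ j < n ] χ′ (punchIn β j) x  ≡⟨ cong (_+ ∑[ j < n ] χ′ (punchIn β j) x) (sym χ′β≡χβ) ⟩
    χ′ β x + ∑[ j < n ] χ′ (punchIn β j) x ≡⟨ sym (sum-remove {i = β} (λ J → χ′ J x)) ⟩
    ∑[ J < v ] χ′ J x                      ≡⟨ sum-cong-≗ (λ J → χ′≡χ+α J x) ⟩
    ∑[ J < v ] (χ J x + α J x)             ≡⟨ ∑-distrib-+ (λ J → χ J x) (λ J → α J x) ⟩
    ∑[ J < v ] χ J x + ∑[ J < v ] α J x    ≡⟨ cong₂ _+_ (replication≡k x) (∑α≡χβ x) ⟩
    k + χ β x                              ≡⟨ +-comm k (χ β x) ⟩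
    χ β x + k                              ∎)
    where
    open ≡-Reasoning
    χ′β≡χβ : χ′ β x ≡ χ β x
    χ′β≡χβ = trans (χ′≡χ+α β x) (trans (cong (χ β x +_) (α-β x)) (+-identityʳ _))

  meet′ bonus : Fin v → Fin v → ℕ
  meet′ J L = ∑[ x < v ] (χ′ J x * χ′ L x)
  bonus J L = ∑[ x < v ] (α J x * χ L x)

  meet′≡λ+bonus : ∀ {J L} → J ≢ L → meet′ J L ≡ λ' + bonus J L + bonus L J
  meet′≡λ+bonus {J} {L} J≢L = begin
    meet′ J L
      ≡⟨ sum-cong-≗ (λ x → trans (cong₂ _*_ (χ′≡χ+α J x) (χ′≡χ+α L x)) (expand x)) ⟩
    ∑[ x < v ] (χ J x * χ L x + α J x * χ L x + α L x * χ J x)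
      ≡⟨ ∑-distrib-+ (λ x → χ J x * χ L x + α J x * χ L x) (λ x → α L x * χ J x) ⟩
    ∑[ x < v ] (χ J x * χ L x + α J x * χ L x) + bonus L J
      ≡⟨ cong (_+ bonus L J) (∑-distrib-+ (λ x → χ J x * χ L x) (λ x → α J x * χ L x)) ⟩
    meet J L + bonus J L + bonus L J
      ≡⟨ cong (λ m → m + bonus J L + bonus L J) (blocks-meet-in-λ J≢L) ⟩
    λ' + bonus J L + bonus L J ∎
    where
    open ≡-Reasoning
    ring : ∀ a b c d → (a + b) * (c + d) ≡ a * c + b * c + d * a + b * d
    ring = solve-∀
    αα≡0 : ∀ x → α J x * α L x ≡ 0
    αα≡0 x = 𝟙*𝟙≡0 _ _ λ x∈AJ x∈AL →
      let i , ci≡J , ei≡x = added⁻ J x x∈AJ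
          j , cj≡L , ej≡x = added⁻ L x x∈AL
      in J≢L (trans (sym ci≡J) (trans (cong c (e-inj (trans ei≡x (sym ej≡x)))) cj≡L))
    expand : ∀ x → (χ J x + α J x) * (χ L x + α L x) ≡ χ J x * χ L x + α J x * χ L x + α L x * χ J x
    expand x = trans (ring (χ J x) (α J x) (χ L x) (α L x)) (trans (cong (χ J x * χ L x + α J x * χ L x + α L x * χ J x +_) (αα≡0 x)) (+-identityʳ _))

  bonus-c : ∀ i L → bonus (c i) L ≡ χ L (e i)
  bonus-c i L = trans (∑-supported (e i) off-ei) (trans (cong (λ a → 𝟙 a * χ L (e i)) (added⁺ i)) (*-identityˡ _))
    where
    off-ei : ∀ x → x ≢ e i → α (c i) x * χ L x ≡ 0
    off-ei x x≢ei = cong (_* χ L x) (𝟙≡0 λ x∈added →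
      let j , cj≡ci , ej≡x = added⁻ (c i) x x∈added in x≢ei (trans (sym ej≡x) (cong e (c-inj cj≡ci))))

  bonus-∉c : ∀ {J} L → (∀ i → c i ≢ J) → bonus J L ≡ 0
  bonus-∉c {J} L J∉c = ∑-zero λ x → cong (_* χ L x) (𝟙≡0 λ x∈added →
    let i , ci≡J , _ = added⁻ J x x∈added in J∉c i ci≡J)

  bonus≤1 : ∀ J L → bonus J L ≤ 1
  bonus≤1 J L with any? (λ i → c i ≟ J)
  ... | yes (i , refl) = subst (_≤ 1) (sym (bonus-c i L)) (𝟙≤1 _)
  ... | no J∉c = subst (_≤ 1) (sym (bonus-∉c L (λ i ci≡J → J∉c (i , ci≡J)))) z≤n

  bonus-asym : ∀ {J L} → J ≢ L → bonus J L ≡ 1 → bonus L J ≡ 0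
  bonus-asym {J} {L} J≢L bonus≡1 with any? (λ i → c i ≟ J) | any? (λ i → c i ≟ L)
  ... | no J∉c | _ with () ← trans (sym bonus≡1) (bonus-∉c L (λ i ci≡J → J∉c (i , ci≡J)))
  ... | yes _ | no L∉c = bonus-∉c J (λ i ci≡L → L∉c (i , ci≡L))
  ... | yes (i , refl) | yes (j , refl) = trans (bonus-c j (c i)) (𝟙≡0 ej∈ci)
    where
    ej∈ci : ¬ (lookup (B (c i)) (e j) ≡ true)
    ej∈ci ej∈ = asym i j (J≢L ∘ cong c)
      (lookup⇒[]= (e i) (B (c j)) (𝟙≡1⇒≡true (trans (sym (bonus-c i (c j))) bonus≡1)))
      (lookup⇒[]= (e j) (B (c i)) ej∈)

  meet′∈[λ,1+λ] : ∀ {J L} → J ≢ L → (meet′ J L ≡ λ') ⊎ (meet′ J L ≡ suc λ')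
  meet′∈[λ,1+λ] {J} {L} J≢L = subst (λ m → (m ≡ λ') ⊎ (m ≡ suc λ')) (sym (meet′≡λ+bonus J≢L))
    (m+a+b≡m⊎m+a+b≡1+m λ' {bonus J L} {bonus L J} (bonus≤1 J L) (bonus≤1 L J) (bonus-asym J≢L))

  D : IncStr n v
  D = dual (removeBlock B′ β)

  pair-count : ∀ j l → ∣ blocksThrough D (⁅ j ⁆ ∪ ⁅ l ⁆) ∣ ≡ meet′ (punchIn β j) (punchIn β l)
  pair-count j l = trans (∣blocksThrough-dual-pair∣ (removeBlock B′ β) j l) (∣p∩q∣≡∑𝟙 (B′ (punchIn β j)) (B′ (punchIn β l)))

  pair-witness : ∀ {J L} → J ≢ L → J ≢ β → L ≢ β →
    ∃ λ S → ∣ S ∣ ≡ 2 × ∣ blocksThrough D S ∣ ≡ meet′ J L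
  pair-witness {J} {L} J≢L J≢β L≢β =
    ⁅ j ⁆ ∪ ⁅ l ⁆ , ∣⁅x⁆∪⁅y⁆∣≡2 j≢l , trans (pair-count j l) (cong₂ meet′ βj≡J βl≡L)
    where
    j = punchOut (J≢β ∘ sym)
    l = punchOut (L≢β ∘ sym)
    βj≡J : punchIn β j ≡ J
    βj≡J = punchIn-punchOut (J≢β ∘ sym)
    βl≡L : punchIn β l ≡ L
    βl≡L = punchIn-punchOut (L≢β ∘ sym)
    j≢l : j ≢ l
    j≢l j≡l = J≢L (trans (sym βj≡J) (trans (cong (punchIn β) j≡l) βl≡L))

  -- e 0 lies on k ≥ 2 blocks of B, among them β but not c 0.
  another-block-through-e₀ : ∃ λ L → L ≢ β × L ≢ c zero × lookup (B L) (e zero) ≡ true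
  another-block-through-e₀
    with any? (λ L → ¬? (L ≟ β) ×-dec ¬? (L ≟ c zero) ×-dec (lookup (B L) (e zero) Bool.≟ true))
  ... | yes found = found
  ... | no none = contradiction (trans (sym (trans (∑-supported β only-β) (cong 𝟙 (e∈Bβ zero)))) (replication≡k (e zero))) λ ()
    where
    only-β : ∀ L → L ≢ β → χ L (e zero) ≡ 0
    only-β L L≢β with L ≟ c zero
    ... | yes refl = 𝟙≡0 (e∉c zero ∘ lookup⇒[]= (e zero) (B (c zero)))
    ... | no L≢c₀ = 𝟙≡0 (λ e₀∈L → none (L , L≢β , L≢c₀ , e₀∈L))

  meet′-c₀≡1+λ : ∀ {L} → c zero ≢ L → lookup (B L) (e zero) ≡ true → meet′ (c zero) L ≡ suc λ'
  meet′-c₀≡1+λ {L} c₀≢L e₀∈L = begin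
    meet′ (c zero) L                         ≡⟨ meet′≡λ+bonus c₀≢L ⟩
    λ' + bonus (c zero) L + bonus L (c zero) ≡⟨ cong₂ (λ a b → λ' + a + b) bonus≡1 (bonus-asym c₀≢L bonus≡1) ⟩
    λ' + 1 + 0                               ≡⟨ trans (+-identityʳ (λ' + 1)) (+-comm λ' 1) ⟩
    suc λ'                                   ∎
    where
    open ≡-Reasoning
    bonus≡1 : bonus (c zero) L ≡ 1
    bonus≡1 = trans (bonus-c zero L) (cong 𝟙 e₀∈L)

  witness-1+λ : ∃ λ S → ∣ S ∣ ≡ 2 × ∣ blocksThrough D S ∣ ≡ suc λ'
  witness-1+λ =
    let L , L≢β , L≢c₀ , e₀∈L = another-block-through-e₀
        S , ∣S∣≡2 , count = pair-witness (L≢c₀ ∘ sym) (c≢β zero) L≢β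
    in S , ∣S∣≡2 , trans count (meet′-c₀≡1+λ (L≢c₀ ∘ sym) e₀∈L)

  k<n : k < n
  k<n = subst (_≤ n) (cong suc (+-comm k₂ 2)) (≤-pred k+2≤v)

  c-misses-a-block : ¬ (∀ j → ∃ λ i → c i ≡ punchIn β j)
  c-misses-a-block onto with pigeonhole k<n (proj₁ ∘ onto)
  ... | j₁ , j₂ , j₁<j₂ , same = Fin.<⇒≢ j₁<j₂ (punchIn-injective β j₁ j₂
    (trans (sym (proj₂ (onto j₁))) (trans (cong c same) (proj₂ (onto j₂)))))

  fresh-block : ∃ λ F → F ≢ β × (∀ i → c i ≢ F)
  fresh-block with any? (λ j → ¬? (any? (λ i → c i ≟ punchIn β j)))
  ... | yes (j , j∉c) = punchIn β j , punchInᵢ≢i β j , λ i ci≡ → j∉c (i , ci≡)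
  ... | no none = ⊥-elim (c-misses-a-block λ j →
    decidable-stable (any? (λ i → c i ≟ punchIn β j)) (λ j∉c → none (j , j∉c)))

  λ≢k : λ' ≢ k
  λ≢k λ≡k = <⇒≢ (*-monoʳ-< k (<⇒≤ k<n)) (trans k*k₁≡n*λ (trans (cong (n *_) λ≡k) (*-comm n k)))

  Bβ⊈other : ∀ {F} → F ≢ β → ∃ λ i → lookup (B F) (e i) ≡ false
  Bβ⊈other {F} F≢β with any? (λ i → lookup (B F) (e i) Bool.≟ false)
  ... | yes found = found
  ... | no none = ⊥-elim (λ≢k (trans (sym (blocks-meet-in-λ (F≢β ∘ sym))) meetβF≡k))
    where
    e∈F : ∀ i → lookup (B F) (e i) ≡ true
    e∈F i with lookup (B F) (e i) in ei∈?F
    ... | true = refl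
    ... | false = ⊥-elim (none (i , ei∈?F))
    ⊆F : ∀ x → lookup (B β) x ≡ true → χ F x ≡ 1
    ⊆F x x∈Bβ with Equivalence.to (Bβ≡e x) (lookup⇒[]= x (B β) x∈Bβ)
    ... | i , refl = cong 𝟙 (e∈F i)
    meetβF≡k : meet β F ≡ k
    meetβF≡k = trans (sum-cong-≗ (λ x → trans (𝟙*-cong (lookup (B β) x) (⊆F x)) (*-identityʳ (χ β x)))) (∑χ≡k β)

  meet′-c-fresh≡λ : ∀ {i F} → (∀ j → c j ≢ F) → lookup (B F) (e i) ≡ false → meet′ (c i) F ≡ λ'
  meet′-c-fresh≡λ {i} {F} F∉c ei∉F = begin
    meet′ (c i) F                      ≡⟨ meet′≡λ+bonus (F∉c i) ⟩
    λ' + bonus (c i) F + bonus F (c i) ≡⟨ cong₂ (λ a b → λ' + a + b) (trans (bonus-c i F) (cong 𝟙 ei∉F)) (bonus-∉c (c i) F∉c) ⟩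
    λ' + 0 + 0                         ≡⟨ trans (+-identityʳ (λ' + 0)) (+-identityʳ λ') ⟩
    λ'                                 ∎
    where open ≡-Reasoning

  witness-λ : ∃ λ S → ∣ S ∣ ≡ 2 × ∣ blocksThrough D S ∣ ≡ λ'
  witness-λ =
    let F , F≢β , F∉c = fresh-block
        i , ei∉F = Bβ⊈other F≢β
        S , ∣S∣≡2 , count = pair-witness (F∉c i) (c≢β i) F≢β
    in S , ∣S∣≡2 , trans count (meet′-c-fresh≡λ F∉c ei∉F)

  pairs-in-[λ,1+λ] : ∀ {j l} → j ≢ l →
    (∣ blocksThrough D (⁅ j ⁆ ∪ ⁅ l ⁆) ∣ ≡ λ') ⊎ (∣ blocksThrough D (⁅ j ⁆ ∪ ⁅ l ⁆) ∣ ≡ suc λ')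
  pairs-in-[λ,1+λ] {j} {l} j≢l = subst (λ m → (m ≡ λ') ⊎ (m ≡ suc λ')) (sym (pair-count j l))
    (meet′∈[λ,1+λ] (j≢l ∘ punchIn-injective β j l))

  isADesign : IsADesign 2 n k λ' D
  isADesign = (λ x → trans (∣dual∣≡∑𝟙 (removeBlock B′ β) x) (dual-block-size x))
    , ∣blocksThrough∣-from-pairs D (λ m → (m ≡ λ') ⊎ (m ≡ suc λ')) pairs-in-[λ,1+λ]
    , witness-λ
    , witness-1+λ

theorem9 : (n k λ' : ℕ) → 2 ≤ k → k + 2 ≤ suc n →
    (B : IncStr (suc n) (suc n)) → IsSymmetricDesign (suc n) k λ' B →
    (β : Fin (suc n)) →
    (e : Fin k → Fin (suc n)) → Injective _≡_ _≡_ e →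
    (∀ x → (x ∈ B β) ⇔ (∃ λ i → e i ≡ x)) →
    (c : Fin k → Fin (suc n)) → Injective _≡_ _≡_ c → (∀ i → c i ≢ β) →
    (∀ i → e i ∉ B (c i)) →
    (∀ j l → j ≢ l → e j ∈ B (c l) → e l ∉ B (c j)) →
    IsADesign 2 n k λ' (dual (removeBlock (adjoin B c e) β))
theorem9 n (suc (suc k₂)) λ' (s≤s (s≤s z≤n)) k+2≤v B design β e e-inj Bβ≡e c c-inj c≢β e∉c asym =
  Modified.isADesign k+2≤v B design β e e-inj Bβ≡e c c-inj c≢β e∉c asym
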